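{- For every subset $\mathcal{E}$ of $\mathcal{P}$, $(\mathbb{P}\text{ - }\mathbf{LPO}[\mathcal{E}]\wedge\mathbf{LPO}[\mathcal{N}])\to\mathbf{LPO}[\mathcal{E}]$. In particular: (1) $\mathbf{LPO}[\mathcal{P}]\leftrightarrow(\mathbb{P}\text{ - }\mathbf{LPO}[\mathcal{P}]\wedge\mathbf{LPO}[\mathcal{N}])$; (2) $\mathbf{LPO}[\mathcal{A}]\leftrightarrow(\mathbb{P}\text{ - }\mathbf{LPO}[\mathcal{A}]\wedge\mathbf{LPO}[\mathcal{N}])$; (3) $\mathbf{LPO}[\mathcal{P}]\leftrightarrow(\mathbb{P}\text{ - }\mathbf{LPO}[\mathcal{P}]\wedge\mathbf{LPO}[\mathcal{A}])$.
   Context: Constructive setting. A potential event is a sequence $\mathsf{e}:\mathbb{N}^{+}\to\{0,1\}$; $\mathcal{P}$ is the set of potential events. Define $\Phi(\mathsf{e})(n)=\frac{\sum_{i=1}^{n}\mathsf{e}(i)}{n}$. An actual event is a pair $(\mathsf{e},\gamma)$ with $\gamma:\mathbb{N}^{+}\to\mathbb{N}^{+}$ strictly increasing and $|\Phi(\mathsf{e})(\gamma(n)+i)-\Phi(\mathsf{e})(\gamma(n)+j)|\le\frac1n$ for all $n\in\mathbb{N}^{+}$, $i,j\in\mathbb{N}$; $\mathbb{P}(\mathsf{e},\gamma):=\Phi(\mathsf{e})\circ\gamma$, a Bishop real (with $x=_{\mathbb{R}}0$ iff $|x(n)|\le\frac2n$ for all $n\in\mathbb{N}^{+}$). $\mathcal{A}$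 is the set of $\mathsf{e}\in\mathcal{P}$ for which some $\gamma$ makes $(\mathsf{e},\gamma)$ actual; $\mathbb{P}[\mathsf{e}]=_{\mathbb{R}}0$ means $\mathsf{e}\in\mathcal{A}$ and $\mathbb{P}(\mathsf{e},\gamma)=_{\mathbb{R}}0$ for every $\gamma$ making $(\mathsf{e},\gamma)$ actual; $\mathcal{N}=\{\mathsf{e}\in\mathcal{P}:\mathbb{P}[\mathsf{e}]=_{\mathbb{R}}0\}$. For $\mathcal{E}\subseteq\mathcal{P}$: $\mathbf{LPO}[\mathcal{E}]$ states that for all $\mathsf{e}\in\mathcal{E}$, $(\forall n\in\mathbb{N}^{+}\,\mathsf{e}(n)=0)\vee(\exists n\in\mathbb{N}^{+}\,\mathsf{e}(n)=1)$; $\mathbb{P}$-$\mathbf{LPO}[\mathcal{E}]$ states that for all $\mathsf{e}\in\mathcal{E}$, $\mathbb{P}[\mathsf{e}]=_{\mathbb{R}}0\vee(\exists n\in\mathbb{N}^{+}\,\mathsf{e}(n)=1)$. -}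

module Defs where

open import Data.Nat using (ℕ; zero; suc; _+_; _<_)
open import Data.Bool using (Bool; true; false)
open import Data.Integer using (+_)
open import Data.Rational using (ℚ; _/_; _-_; ∣_∣; _≤_)
open import Data.Product using (Σ; _×_; ∃)
open import Data.Sum using (_⊎_)
open import Data.Unit using (⊤)
open import Relation.Binary.PropositionalEquality using (_≡_)

-- ENCODING of ℕ⁺: a function f : ℕ⁺ → X is represented by f' : ℕ → X
-- with f' k = f (k + 1).  A map γ : ℕ⁺ → ℕ⁺ is represented by
-- γ' : ℕ → ℕ with γ' k = γ (k + 1) - 1.

-- Potential events: e k represents 𝖾(k+1) ∈ {0,1}  (false = 0, true = 1).
PotentialEvent : Set
PotentialEvent = ℕ → Bool

𝒫 : PotentialEvent → Set
𝒫 _ = ⊤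

bit : Bool → ℕ
bit true  = 1
bit false = 0

count : PotentialEvent → ℕ → ℕ
count e zero    = 0
count e (suc n) = count e n + bit (e n)

-- Φ e k = Φ(𝖾)(k+1) = (Σ_{i=1}^{k+1} 𝖾(i)) / (k+1)
Φ : PotentialEvent → ℕ → ℚ
Φ e k = (+ count e (suc k)) / suc k

StrictlyIncreasing : (ℕ → ℕ) → Set
StrictlyIncreasing γ = ∀ m n → m < n → γ m < γ n

-- (𝖾, γ) is an actual event.  With n = m+1 and γ(n) = γ m + 1, the term
-- Φ(𝖾)(γ(n)+i) is  Φ e (γ m + i).
IsActual : PotentialEvent → (ℕ → ℕ) → Set
IsActual e γ = StrictlyIncreasing γ
  × (∀ m i j → ∣ Φ e (γ m + i) - Φ e (γ m + j) ∣ ≤ (+ 1) / suc m)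

-- Bishop reals as regular sequences ℕ⁺ → ℚ (shifted encoding)
ℝseq : Set
ℝseq = ℕ → ℚ

_=ℝ0 : ℝseq → Set
x =ℝ0 = ∀ m → ∣ x m ∣ ≤ (+ 2) / suc m

ℙ : PotentialEvent → (ℕ → ℕ) → ℝseq
ℙ e γ m = Φ e (γ m)

𝒜 : PotentialEvent → Set
𝒜 e = Σ (ℕ → ℕ) (λ γ → IsActual e γ)

ℙ[_]=ℝ0 : PotentialEvent → Set
ℙ[ e ]=ℝ0 = 𝒜 e × (∀ γ → IsActual e γ → ℙ e γ =ℝ0)

𝒩 : PotentialEvent → Set
𝒩 e = ℙ[ e ]=ℝ0

LPO[_] : (PotentialEvent → Set) → Set
LPO[ E ] = ∀ e → E e → (∀ n → e n ≡ false) ⊎ (∃ λ n → e n ≡ true)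

ℙ-LPO[_] : (PotentialEvent → Set) → Set
ℙ-LPO[ E ] = ∀ e → E e → ℙ[ e ]=ℝ0 ⊎ (∃ λ n → e n ≡ true)

-- The nontrivial direction is a case split on ℙ-LPO: a witness e n = 1 is
-- already the LPO answer, and ℙ[e] = 0 puts e in 𝒩, where LPO[𝒩] decides it.
-- Conversely LPO gives ℙ-LPO because the zero sequence has probability 0
-- along the identity, and LPO descends to the subsets 𝒩 ⊆ 𝒜 ⊆ 𝒫.
module Submission where

open import Defs
open import Data.Bool using (false)
open import Data.Integer using (+_)
open import Data.Nat using (zero; suc; _+_)
open import Data.Product using (_×_; _,_; proj₁)
open import Data.Rational using (0ℚ; _/_; _-_; ∣_∣; _≤_)
open import Data.Rational.Properties using (0/n≡0; normalize-nonNeg; nonNegative⁻¹)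
open import Data.Sum using (inj₁; inj₂)
open import Data.Unit using (tt)
open import Function.Bundles using (_⇔_; mk⇔)
open import Relation.Binary.PropositionalEquality using (_≡_; refl)
open import Relation.Unary using (_⊆_)

AllZero : PotentialEvent → Set
AllZero e = ∀ n → e n ≡ false

count-allZero : ∀ {e} → AllZero e → ∀ n → count e n ≡ 0
count-allZero z zero = refl
count-allZero z (suc n) rewrite count-allZero z n | z n = refl

Φ-allZero : ∀ {e} → AllZero e → ∀ k → Φ e k ≡ 0ℚ
Φ-allZero {e} z k rewrite count-allZero z (suc k) = 0/n≡0 (suc k)

0≤k/suc : ∀ k m → 0ℚ ≤ (+ k) / suc m
0≤k/suc k m = nonNegative⁻¹ _ {{normalize-nonNeg k (suc m)}}

allZero⇒ℙ=0 : ∀ {e} → AllZero e → ℙ[ e ]=ℝ0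
allZero⇒ℙ=0 {e} z = ((λ n → n) , (λ _ _ m<n → m<n) , regular) , λ γ _ → ℙ=0 γ
  where
  regular : ∀ m i j → ∣ Φ e (m + i) - Φ e (m + j) ∣ ≤ (+ 1) / suc m
  regular m i j rewrite Φ-allZero z (m + i) | Φ-allZero z (m + j) = 0≤k/suc 1 m

  ℙ=0 : ∀ γ → ℙ e γ =ℝ0
  ℙ=0 γ m rewrite Φ-allZero z (γ m) = 0≤k/suc 2 m

𝒩⊆𝒜 : 𝒩 ⊆ 𝒜
𝒩⊆𝒜 = proj₁

𝒜⊆𝒫 : 𝒜 ⊆ 𝒫
𝒜⊆𝒫 _ = tt

LPO-anti : ∀ {E F : PotentialEvent → Set} → E ⊆ F → LPO[ F ] → LPO[ E ]
LPO-anti E⊆F lpo e e∈E = lpo e (E⊆F e∈E)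

LPO⇒ℙ-LPO : ∀ E → LPO[ E ] → ℙ-LPO[ E ]
LPO⇒ℙ-LPO E lpo e e∈E with lpo e e∈E
... | inj₁ z = inj₁ (allZero⇒ℙ=0 z)
... | inj₂ hit = inj₂ hit

ℙ-LPO×LPO𝒩⇒LPO : ∀ E → ℙ-LPO[ E ] × LPO[ 𝒩 ] → LPO[ E ]
ℙ-LPO×LPO𝒩⇒LPO E (ℙ-lpo , lpo𝒩) e e∈E with ℙ-lpo e e∈E
... | inj₁ e∈𝒩 = lpo𝒩 e e∈𝒩
... | inj₂ hit = inj₂ hit

LPO⇔ℙ-LPO×LPO𝒩 : ∀ {E} → 𝒩 ⊆ E → LPO[ E ] ⇔ (ℙ-LPO[ E ] × LPO[ 𝒩 ])
LPO⇔ℙ-LPO×LPO𝒩 {E} 𝒩⊆E =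
  mk⇔ (λ lpo → LPO⇒ℙ-LPO E lpo , LPO-anti 𝒩⊆E lpo) (ℙ-LPO×LPO𝒩⇒LPO E)

mainTheorem18 : (∀ (E : PotentialEvent → Set) → ℙ-LPO[ E ] × LPO[ 𝒩 ] → LPO[ E ])
    × (LPO[ 𝒫 ] ⇔ (ℙ-LPO[ 𝒫 ] × LPO[ 𝒩 ]))
    × (LPO[ 𝒜 ] ⇔ (ℙ-LPO[ 𝒜 ] × LPO[ 𝒩 ]))
    × (LPO[ 𝒫 ] ⇔ (ℙ-LPO[ 𝒫 ] × LPO[ 𝒜 ]))
mainTheorem18 =
    ℙ-LPO×LPO𝒩⇒LPO
  , LPO⇔ℙ-LPO×LPO𝒩 (λ e∈𝒩 → 𝒜⊆𝒫 (𝒩⊆𝒜 e∈𝒩))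
  , LPO⇔ℙ-LPO×LPO𝒩 𝒩⊆𝒜
  , mk⇔ (λ lpo → LPO⇒ℙ-LPO 𝒫 lpo , LPO-anti 𝒜⊆𝒫 lpo)
        (λ (ℙ-lpo , lpo𝒜) → ℙ-LPO×LPO𝒩⇒LPO 𝒫 (ℙ-lpo , LPO-anti 𝒩⊆𝒜 lpo𝒜))
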